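{- Let $(\mathbf{C},\mathcal{M})$ be an $\mathcal{M}$-adhesive category satisfying the horizontal VK property and having effective pushouts. Let $TG_B\xleftarrow{tg_{DB}}TG_D\xrightarrow{tg_{DC}}TG_C$, $TG_B\xrightarrow{tg_{BA}}TG_A\xleftarrow{tg_{CA}}TG_C$ be a pushout square (1) with all four morphisms in $\mathcal{M}$. (Composition) If typed objects $g_B:G_B\to TG_B$ and $g_C:G_C\to TG_C$ agree in $g_D:G_D\to TG_D$, then there exists an amalgamation $g_A=g_B+_{g_D}g_C$, and it is unique up to isomorphism. (Decomposition) Conversely, for every $g_A:G_A\to TG_A$ there are restrictions $g_B,g_C,g_D$ of $g_A$, unique up to isomorphism, such that $g_A=g_B+_{g_D}g_C$.
   Context: An $\mathcal{M}$-adhesive category $(\mathbf{C},\mathcal{M})$: a category $\mathbf{C}$ with a class $\mathcal{M}$ of monomorphisms closed under isomorphisms, composition and decomposition, such that $\mathbf{C}$ has pushouts and pullbacks along $\mathcal{M}$-morphisms, $\mathcal{M}$ is stable under pushouts and pullbacks, and pushouts along $\mathcal{M}$-morphisms satisfy the vertical VK property (for every commutative cube with such a pushout as bottom, vertical morphisms in $\mathcal{M}$ and pullbacks as back faces, the top face is a pushout iff the front faces are pullbacks). Horizontal VK property: the same condition for commutative cubes whose horizontal morphisms are all in $\mathcal{M}$. Effective pushouts: for $a:B\to X$, $b:C\to X$ in $\mathcal{M}$ with pullback $B\leftarrow A\to C$, the morphism to $X$ induced from the pushout of $B\leftarrow A\to C$ is in $\mathcal{M}$. An object typed over $TG$ is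 a morphism $g:G\to TG$. For $t:TG'\to TG\in\mathcal{M}$, a restriction of $g:G\to TG$ along $t$ is $g':G'\to TG'$ together with $G'\to G$ making the square with $t$ a pullback. Given the pushout (1): $g_B,g_C$ agree in $g_D$ if $g_D$ is a restriction of $g_B$ along $tg_{DB}$ and of $g_C$ along $tg_{DC}$. A morphism $g_A:G_A\to TG_A$ is an amalgamation of $g_B$ and $g_C$ over $g_D$, written $g_A=g_B+_{g_D}g_C$, if $g_B,g_C$ agree in $g_D$, $g_B$ and $g_C$ are restrictions of $g_A$ along $tg_{BA}$ and $tg_{CA}$, and the square formed by $G_D\to G_B$, $G_D\to G_C$, $G_B\to G_A$, $G_C\to G_A$ (the morphisms coming with the restrictions) is a pushout. -}

module Defs where

open import Level using (Level; _⊔_; suc)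
open import Data.Product using (Σ; _×_; _,_; proj₁; proj₂)
open import Relation.Binary using (IsEquivalence)

record Category (o ℓ e : Level) : Set (suc (o ⊔ ℓ ⊔ e)) where
  infixr 9 _∘_
  infix  4 _≈_
  field
    Obj   : Set o
    Hom   : Obj → Obj → Set ℓ
    _≈_   : ∀ {A B} → Hom A B → Hom A B → Set e
    ≈-equiv : ∀ {A B} → IsEquivalence (_≈_ {A} {B})
    id    : ∀ {A} → Hom A A
    _∘_   : ∀ {A B C} → Hom B C → Hom A B → Hom A C
    assoc : ∀ {A B C D} {f : Hom A B} {g : Hom B C} {h : Hom C D} →
            (h ∘ g) ∘ f ≈ h ∘ (g ∘ f)
    identityˡ : ∀ {A B} {f : Hom A B} → id ∘ f ≈ f
    identityʳ : ∀ {A B} {f : Hom A B} → f ∘ id ≈ f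
    ∘-resp-≈  : ∀ {A B C} {f h : Hom B C} {g i : Hom A B} →
                f ≈ h → g ≈ i → f ∘ g ≈ h ∘ i

module CatDefs {o ℓ e : Level} (𝐂 : Category o ℓ e) where
  open Category 𝐂

  IsMono : ∀ {A B} → Hom A B → Set (o ⊔ ℓ ⊔ e)
  IsMono {A} f = ∀ {X} (g h : Hom X A) → f ∘ g ≈ f ∘ h → g ≈ h

  IsIso : ∀ {A B} → Hom A B → Set (ℓ ⊔ e)
  IsIso {A} {B} f = Σ (Hom B A) λ g → (g ∘ f ≈ id) × (f ∘ g ≈ id)

  record IsPullback {P X Y Z : Obj} (p₁ : Hom P X) (p₂ : Hom P Y)
                    (f : Hom X Z) (g : Hom Y Z) : Set (o ⊔ ℓ ⊔ e) where
    field
      commute   : f ∘ p₁ ≈ g ∘ p₂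
      universal : ∀ {Q} (q₁ : Hom Q X) (q₂ : Hom Q Y) → f ∘ q₁ ≈ g ∘ q₂ →
                  Σ (Hom Q P) λ u → (p₁ ∘ u ≈ q₁) × (p₂ ∘ u ≈ q₂) ×
                    (∀ (v : Hom Q P) → p₁ ∘ v ≈ q₁ → p₂ ∘ v ≈ q₂ → v ≈ u)

  record IsPushout {A B C P : Obj} (f : Hom A B) (g : Hom A C)
                   (i₁ : Hom B P) (i₂ : Hom C P) : Set (o ⊔ ℓ ⊔ e) where
    field
      commute   : i₁ ∘ f ≈ i₂ ∘ g
      universal : ∀ {Q} (q₁ : Hom B Q) (q₂ : Hom C Q) → q₁ ∘ f ≈ q₂ ∘ g →
                  Σ (Hom P Q) λ u → (u ∘ i₁ ≈ q₁) × (u ∘ i₂ ≈ q₂) ×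
                    (∀ (v : Hom P Q) → v ∘ i₁ ≈ q₁ → v ∘ i₂ ≈ q₂ → v ≈ u)

  record Cube : Set (o ⊔ ℓ ⊔ e) where
    field
      {A B C D A' B' C' D'} : Obj
      m  : Hom A B
      n  : Hom A C
      f  : Hom B D
      g  : Hom C D
      m' : Hom A' B'
      n' : Hom A' C'
      f' : Hom B' D'
      g' : Hom C' D'
      a  : Hom A' A
      b  : Hom B' B
      c  : Hom C' C
      d  : Hom D' D
      bottom-commute : f ∘ m ≈ g ∘ n
      top-commute    : f' ∘ m' ≈ g' ∘ n'
      backB-commute  : b ∘ m' ≈ m ∘ a
      backC-commute  : c ∘ n' ≈ n ∘ a
      frontB-commute : d ∘ f' ≈ f ∘ b
      frontC-commute : d ∘ g' ≈ g ∘ c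

    BottomPushout : Set (o ⊔ ℓ ⊔ e)
    BottomPushout = IsPushout m n f g
    TopPushout : Set (o ⊔ ℓ ⊔ e)
    TopPushout = IsPushout m' n' f' g'
    BackPullbacks : Set (o ⊔ ℓ ⊔ e)
    BackPullbacks = IsPullback m' a b m × IsPullback n' a c n
    FrontPullbacks : Set (o ⊔ ℓ ⊔ e)
    FrontPullbacks = IsPullback f' b d f × IsPullback g' c d g

  MorClass : (m : Level) → Set (o ⊔ ℓ ⊔ suc m)
  MorClass m = ∀ {A B} → Hom A B → Set m

  module _ {mℓ : Level} (M : MorClass mℓ) where

    record IsMAdhesive : Set (o ⊔ ℓ ⊔ e ⊔ mℓ) where
      field
        monos       : ∀ {A B} (f : Hom A B) → M f → IsMono f
        iso-closedʳ : ∀ {A B C} (f : Hom B C) (i : Hom A B) → M f → IsIso i → M (f ∘ i)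
        iso-closedˡ : ∀ {A B C} (i : Hom B C) (f : Hom A B) → M f → IsIso i → M (i ∘ f)
        comp-closed : ∀ {A B C} (g : Hom B C) (f : Hom A B) → M g → M f → M (g ∘ f)
        decomp      : ∀ {A B C} (g : Hom B C) (f : Hom A B) → M (g ∘ f) → M g → M f
        pushouts-along-M : ∀ {A B C} (m : Hom A B) (g : Hom A C) → M m →
                    Σ Obj λ P → Σ (Hom B P) λ i₁ → Σ (Hom C P) λ i₂ → IsPushout m g i₁ i₂
        pullbacks-along-M : ∀ {B C D} (m : Hom B D) (f : Hom C D) → M m →
                    Σ Obj λ P → Σ (Hom P C) λ p₁ → Σ (Hom P B) λ p₂ → IsPullback p₁ p₂ f m
        pushout-stable : ∀ {A B C P} (f : Hom A B) (g : Hom A C) (i₁ : Hom B P) (i₂ : Hom C P) →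
                    IsPushout f g i₁ i₂ → M f → M i₂
        pullback-stable : ∀ {P X Y Z} (p₁ : Hom P X) (p₂ : Hom P Y) (f : Hom X Z) (g : Hom Y Z) →
                    IsPullback p₁ p₂ f g → M g → M p₁
        vertical-VK : (K : Cube) → let open Cube K in
                    M m → BottomPushout → M a → M b → M c → M d → BackPullbacks →
                    (TopPushout → FrontPullbacks) × (FrontPullbacks → TopPushout)

    HorizontalVK : Set (o ⊔ ℓ ⊔ e ⊔ mℓ)
    HorizontalVK = (K : Cube) → let open Cube K in
                    M m → M n → M f → M g → M m' → M n' → M f' → M g' →
                    BottomPushout → BackPullbacks →
                    (TopPushout → FrontPullbacks) × (FrontPullbacks → TopPushout)

    EffectivePushouts : Set (o ⊔ ℓ ⊔ e ⊔ mℓ)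
    EffectivePushouts = ∀ {A B C X P} (a : Hom B X) (b : Hom C X)
                    (p₁ : Hom A B) (p₂ : Hom A C) → M a → M b → IsPullback p₁ p₂ a b →
                    (i₁ : Hom B P) (i₂ : Hom C P) → IsPushout p₁ p₂ i₁ i₂ →
                    (u : Hom P X) → u ∘ i₁ ≈ a → u ∘ i₂ ≈ b → M u

  -- Typed objects: a typed object over TG is a morphism g : G → TG.

  IsRestrictionVia : ∀ {G G' TG TG'} (t : Hom TG' TG) (g : Hom G TG)
                     (g' : Hom G' TG') (h : Hom G' G) → Set (o ⊔ ℓ ⊔ e)
  IsRestrictionVia t g g' h = IsPullback h g' g t

  IsRestriction : ∀ {G G' TG TG'} (t : Hom TG' TG) (g : Hom G TG)
                  (g' : Hom G' TG') → Set (o ⊔ ℓ ⊔ e)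
  IsRestriction {G} {G'} t g g' = Σ (Hom G' G) λ h → IsRestrictionVia t g g' h

  TypedIso : ∀ {G G' TG} (g : Hom G TG) (g' : Hom G' TG) → Set (ℓ ⊔ e)
  TypedIso {G} {G'} g g' = Σ (Hom G G') λ i → IsIso i × (g' ∘ i ≈ g)

  module Square {TGA TGB TGC TGD : Obj}
                (tgDB : Hom TGD TGB) (tgDC : Hom TGD TGC)
                (tgBA : Hom TGB TGA) (tgCA : Hom TGC TGA) where

    Agree : ∀ {GB GC GD} (gB : Hom GB TGB) (gC : Hom GC TGC) (gD : Hom GD TGD)
            (hDB : Hom GD GB) (hDC : Hom GD GC) → Set (o ⊔ ℓ ⊔ e)
    Agree gB gC gD hDB hDC =
      IsRestrictionVia tgDB gB gD hDB × IsRestrictionVia tgDC gC gD hDC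

    IsAmalgamation : ∀ {GA GB GC GD} (gA : Hom GA TGA) (gB : Hom GB TGB)
            (gC : Hom GC TGC) (gD : Hom GD TGD)
            (hDB : Hom GD GB) (hDC : Hom GD GC) → Set (o ⊔ ℓ ⊔ e)
    IsAmalgamation {GA} {GB} {GC} gA gB gC gD hDB hDC =
      Agree gB gC gD hDB hDC ×
      Σ (Hom GB GA) λ hBA → Σ (Hom GC GA) λ hCA →
        IsRestrictionVia tgBA gA gB hBA ×
        IsRestrictionVia tgCA gA gC hCA ×
        IsPushout hDB hDC hBA hCA

    record Decomposition {GA : Obj} (gA : Hom GA TGA) : Set (o ⊔ ℓ ⊔ e) where
      field
        {GB GC GD} : Obj
        gB  : Hom GB TGB
        gC  : Hom GC TGC
        gD  : Hom GD TGD
        hDB : Hom GD GB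
        hDC : Hom GD GC
        gD-restriction : IsRestriction (tgBA ∘ tgDB) gA gD
        amalgamation   : IsAmalgamation gA gB gC gD hDB hDC

    CompositionProperty : Set (o ⊔ ℓ ⊔ e)
    CompositionProperty =
      ∀ {GB GC GD} (gB : Hom GB TGB) (gC : Hom GC TGC) (gD : Hom GD TGD)
        (hDB : Hom GD GB) (hDC : Hom GD GC) → Agree gB gC gD hDB hDC →
        (Σ Obj λ GA → Σ (Hom GA TGA) λ gA → IsAmalgamation gA gB gC gD hDB hDC)
        × (∀ {GA GA'} (gA : Hom GA TGA) (gA' : Hom GA' TGA) →
             IsAmalgamation gA gB gC gD hDB hDC →
             IsAmalgamation gA' gB gC gD hDB hDC → TypedIso gA gA')

    DecompositionProperty : Set (o ⊔ ℓ ⊔ e)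
    DecompositionProperty =
      ∀ {GA} (gA : Hom GA TGA) →
        Decomposition gA ×
        (∀ (δ δ' : Decomposition gA) →
           TypedIso (Decomposition.gB δ) (Decomposition.gB δ') ×
           TypedIso (Decomposition.gC δ) (Decomposition.gC δ') ×
           TypedIso (Decomposition.gD δ) (Decomposition.gD δ'))

module Submission where

-- Every configuration met below lies in one cube: the
-- bottom face is (1), the vertical edges are the typings g_D, g_B, g_C,
-- g_A, and the back faces are pullbacks exactly when g_B and g_C agree
-- in g_D.  The horizontal VK property then says: the top face is a
-- pushout iff the front faces are pullbacks, i.e. iff g_B and g_C are
-- restrictions of g_A.  Hence
--   * composition: push out G_B <- G_D -> G_C (possible since restriction
--     legs along M-morphisms are in M), type it by the induced g_A, and
--     VK turns the front faces into pullbacks;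
--   * decomposition: pull g_A back along tg_BA, tg_CA and tg_BA ∘ tg_DB;
--     pullback cancellation gives the agreement, VK gives the pushout.
-- Uniqueness in both directions is uniqueness of pushouts resp. pullbacks
-- up to isomorphism.

open import Defs
open import Level using (Level)
open import Data.Product using (_×_; Σ; _,_; proj₁; proj₂)
open import Relation.Binary using (IsEquivalence; Setoid)
import Relation.Binary.Reasoning.Setoid as SetoidReasoning

module CategoryFacts {o ℓ e : Level} (𝐂 : Category o ℓ e) where
  open Category 𝐂
  open CatDefs 𝐂

  ≈-refl : ∀ {A B} {f : Hom A B} → f ≈ f
  ≈-refl = IsEquivalence.refl ≈-equiv

  ≈-sym : ∀ {A B} {f g : Hom A B} → f ≈ g → g ≈ f
  ≈-sym = IsEquivalence.sym ≈-equiv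

  ≈-trans : ∀ {A B} {f g h : Hom A B} → f ≈ g → g ≈ h → f ≈ h
  ≈-trans = IsEquivalence.trans ≈-equiv

  homSetoid : Obj → Obj → Setoid ℓ e
  homSetoid A B = record { Carrier = Hom A B ; _≈_ = _≈_ ; isEquivalence = ≈-equiv }

  open module HomReasoning {A} {B} = SetoidReasoning (homSetoid A B) public

  assoc⁻¹ : ∀ {A B C D} {f : Hom A B} {g : Hom B C} {h : Hom C D} →
            h ∘ (g ∘ f) ≈ (h ∘ g) ∘ f
  assoc⁻¹ = ≈-sym assoc

  refl⟩∘⟨_ : ∀ {A B C} {f : Hom B C} {g i : Hom A B} → g ≈ i → f ∘ g ≈ f ∘ i
  refl⟩∘⟨ p = ∘-resp-≈ ≈-refl p

  _⟩∘⟨refl : ∀ {A B C} {f h : Hom B C} {g : Hom A B} → f ≈ h → f ∘ g ≈ h ∘ g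
  p ⟩∘⟨refl = ∘-resp-≈ p ≈-refl

  module Pushout {A B C P : Obj} {f : Hom A B} {g : Hom A C}
                 {i₁ : Hom B P} {i₂ : Hom C P} (po : IsPushout f g i₁ i₂) where
    open IsPushout po public

    mediator : ∀ {Q} (q₁ : Hom B Q) (q₂ : Hom C Q) → q₁ ∘ f ≈ q₂ ∘ g → Hom P Q
    mediator q₁ q₂ c = proj₁ (universal q₁ q₂ c)

    mediator-i₁ : ∀ {Q} {q₁ : Hom B Q} {q₂ : Hom C Q} (c : q₁ ∘ f ≈ q₂ ∘ g) →
                  mediator q₁ q₂ c ∘ i₁ ≈ q₁
    mediator-i₁ {q₁ = q₁} {q₂} c = proj₁ (proj₂ (universal q₁ q₂ c))

    mediator-i₂ : ∀ {Q} {q₁ : Hom B Q} {q₂ : Hom C Q} (c : q₁ ∘ f ≈ q₂ ∘ g) →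
                  mediator q₁ q₂ c ∘ i₂ ≈ q₂
    mediator-i₂ {q₁ = q₁} {q₂} c = proj₁ (proj₂ (proj₂ (universal q₁ q₂ c)))

    jointly-epi : ∀ {Q} {v w : Hom P Q} → v ∘ i₁ ≈ w ∘ i₁ → v ∘ i₂ ≈ w ∘ i₂ → v ≈ w
    jointly-epi {v = v} {w} e₁ e₂ =
      ≈-trans (unique v e₁ e₂) (≈-sym (unique w ≈-refl ≈-refl))
      where
      w-commutes : (w ∘ i₁) ∘ f ≈ (w ∘ i₂) ∘ g
      w-commutes = ≈-trans assoc (≈-trans (refl⟩∘⟨ commute) assoc⁻¹)
      unique = proj₂ (proj₂ (proj₂ (universal (w ∘ i₁) (w ∘ i₂) w-commutes)))

  module Pullback {P X Y Z : Obj} {p₁ : Hom P X} {p₂ : Hom P Y}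
                  {f : Hom X Z} {g : Hom Y Z} (pb : IsPullback p₁ p₂ f g) where
    open IsPullback pb public

    mediator : ∀ {Q} (q₁ : Hom Q X) (q₂ : Hom Q Y) → f ∘ q₁ ≈ g ∘ q₂ → Hom Q P
    mediator q₁ q₂ c = proj₁ (universal q₁ q₂ c)

    mediator-p₁ : ∀ {Q} {q₁ : Hom Q X} {q₂ : Hom Q Y} (c : f ∘ q₁ ≈ g ∘ q₂) →
                  p₁ ∘ mediator q₁ q₂ c ≈ q₁
    mediator-p₁ {q₁ = q₁} {q₂} c = proj₁ (proj₂ (universal q₁ q₂ c))

    mediator-p₂ : ∀ {Q} {q₁ : Hom Q X} {q₂ : Hom Q Y} (c : f ∘ q₁ ≈ g ∘ q₂) →
                  p₂ ∘ mediator q₁ q₂ c ≈ q₂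
    mediator-p₂ {q₁ = q₁} {q₂} c = proj₁ (proj₂ (proj₂ (universal q₁ q₂ c)))

    mediator-unique : ∀ {Q} {q₁ : Hom Q X} {q₂ : Hom Q Y} (c : f ∘ q₁ ≈ g ∘ q₂)
                      (v : Hom Q P) → p₁ ∘ v ≈ q₁ → p₂ ∘ v ≈ q₂ → v ≈ mediator q₁ q₂ c
    mediator-unique {q₁ = q₁} {q₂} c = proj₂ (proj₂ (proj₂ (universal q₁ q₂ c)))

    jointly-mono : ∀ {Q} {v w : Hom Q P} → p₁ ∘ v ≈ p₁ ∘ w → p₂ ∘ v ≈ p₂ ∘ w → v ≈ w
    jointly-mono {v = v} {w} e₁ e₂ =
      ≈-trans (mediator-unique c v e₁ e₂) (≈-sym (mediator-unique c w ≈-refl ≈-refl))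
      where
      c : f ∘ (p₁ ∘ w) ≈ g ∘ (p₂ ∘ w)
      c = ≈-trans assoc⁻¹ (≈-trans (commute ⟩∘⟨refl) assoc)

  pushout-round-trip :
    ∀ {A B C P P'} {f : Hom A B} {g : Hom A C}
      {i₁ : Hom B P} {i₂ : Hom C P} {j₁ : Hom B P'} {j₂ : Hom C P'}
      (po : IsPushout f g i₁ i₂) (po' : IsPushout f g j₁ j₂) →
    Pushout.mediator po' i₁ i₂ (Pushout.commute po)
      ∘ Pushout.mediator po j₁ j₂ (Pushout.commute po') ≈ id
  pushout-round-trip {i₁ = i₁} {i₂} {j₁} {j₂} po po' =
    Pushout.jointly-epi po
      (begin
        (back ∘ there) ∘ i₁ ≈⟨ assoc ⟩
        back ∘ (there ∘ i₁) ≈⟨ refl⟩∘⟨ Pushout.mediator-i₁ po _ ⟩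
        back ∘ j₁           ≈⟨ Pushout.mediator-i₁ po' _ ⟩
        i₁                  ≈⟨ ≈-sym identityˡ ⟩
        id ∘ i₁             ∎)
      (begin
        (back ∘ there) ∘ i₂ ≈⟨ assoc ⟩
        back ∘ (there ∘ i₂) ≈⟨ refl⟩∘⟨ Pushout.mediator-i₂ po _ ⟩
        back ∘ j₂           ≈⟨ Pushout.mediator-i₂ po' _ ⟩
        i₂                  ≈⟨ ≈-sym identityˡ ⟩
        id ∘ i₂             ∎)
    where
    there = Pushout.mediator po j₁ j₂ (Pushout.commute po')
    back = Pushout.mediator po' i₁ i₂ (Pushout.commute po)

  pushout-comparison-iso :
    ∀ {A B C P P'} {f : Hom A B} {g : Hom A C}
      {i₁ : Hom B P} {i₂ : Hom C P} {j₁ : Hom B P'} {j₂ : Hom C P'}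
      (po : IsPushout f g i₁ i₂) (po' : IsPushout f g j₁ j₂) →
    IsIso (Pushout.mediator po j₁ j₂ (Pushout.commute po'))
  pushout-comparison-iso po po' =
    Pushout.mediator po' _ _ (Pushout.commute po) ,
    pushout-round-trip po po' , pushout-round-trip po' po

  pullback-round-trip :
    ∀ {P P' X Y Z} {f : Hom X Z} {g : Hom Y Z}
      {p₁ : Hom P X} {p₂ : Hom P Y} {q₁ : Hom P' X} {q₂ : Hom P' Y}
      (pb : IsPullback p₁ p₂ f g) (pb' : IsPullback q₁ q₂ f g) →
    Pullback.mediator pb q₁ q₂ (Pullback.commute pb')
      ∘ Pullback.mediator pb' p₁ p₂ (Pullback.commute pb) ≈ id
  pullback-round-trip {p₁ = p₁} {p₂} {q₁} {q₂} pb pb' =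
    Pullback.jointly-mono pb
      (begin
        p₁ ∘ (back ∘ there) ≈⟨ assoc⁻¹ ⟩
        (p₁ ∘ back) ∘ there ≈⟨ Pullback.mediator-p₁ pb _ ⟩∘⟨refl ⟩
        q₁ ∘ there          ≈⟨ Pullback.mediator-p₁ pb' _ ⟩
        p₁                  ≈⟨ ≈-sym identityʳ ⟩
        p₁ ∘ id             ∎)
      (begin
        p₂ ∘ (back ∘ there) ≈⟨ assoc⁻¹ ⟩
        (p₂ ∘ back) ∘ there ≈⟨ Pullback.mediator-p₂ pb _ ⟩∘⟨refl ⟩
        q₂ ∘ there          ≈⟨ Pullback.mediator-p₂ pb' _ ⟩
        p₂                  ≈⟨ ≈-sym identityʳ ⟩
        p₂ ∘ id             ∎)
    where
    there = Pullback.mediator pb' p₁ p₂ (Pullback.commute pb)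
    back = Pullback.mediator pb q₁ q₂ (Pullback.commute pb')

  -- Restrictions along the same morphism are unique up to isomorphism
  -- (two pullbacks of the same cospan are isomorphic over its corner).
  restrictions-unique : ∀ {G G₁ G₂ TG TG'} {t : Hom TG' TG} {g : Hom G TG}
                        {g₁ : Hom G₁ TG'} {g₂ : Hom G₂ TG'} →
                        IsRestriction t g g₁ → IsRestriction t g g₂ → TypedIso g₁ g₂
  restrictions-unique (h₁ , pb₁) (h₂ , pb₂) =
    Pullback.mediator pb₂ h₁ _ (Pullback.commute pb₁) ,
    (Pullback.mediator pb₁ h₂ _ (Pullback.commute pb₂) ,
     pullback-round-trip pb₁ pb₂ , pullback-round-trip pb₂ pb₁) ,
    Pullback.mediator-p₂ pb₂ (Pullback.commute pb₁)

  pushout-swap : ∀ {A B C P} {f : Hom A B} {g : Hom A C} {i₁ : Hom B P} {i₂ : Hom C P} →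
                 IsPushout f g i₁ i₂ → IsPushout g f i₂ i₁
  pushout-swap po = record
    { commute = ≈-sym (Pushout.commute po)
    ; universal = λ q₁ q₂ c →
        let (u , u-i₂ , u-i₁ , unique) = Pushout.universal po q₂ q₁ (≈-sym c)
        in u , u-i₁ , u-i₂ , λ v v-i₂ v-i₁ → unique v v-i₁ v-i₂ }

  pullback-cancel :
    ∀ {G₀ G G' T₀ T T'} {h : Hom G₀ G} {h' : Hom G G'} {k : Hom G₀ G'}
      {g₀ : Hom G₀ T₀} {g : Hom G T} {g' : Hom G' T'}
      {t : Hom T₀ T} {s : Hom T T'} {w : Hom T₀ T'} →
    IsPullback h' g g' s → IsPullback k g₀ g' w → w ≈ s ∘ t →
    h' ∘ h ≈ k → g ∘ h ≈ t ∘ g₀ → IsPullback h g₀ g t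
  pullback-cancel {G = G} {T₀ = T₀} {h = h} {h'} {k} {g₀} {g} {g'} {t} {s} {w}
                  right outer w≈s∘t h'h≈k gh≈tg₀ =
    record
    { commute = gh≈tg₀
    ; universal = λ q₁ q₂ c →
        let c' = outer-commutes q₁ q₂ c
            u = Pullback.mediator outer (h' ∘ q₁) q₂ c'
            h'hu≈h'q₁ : h' ∘ (h ∘ u) ≈ h' ∘ q₁
            h'hu≈h'q₁ = begin
              h' ∘ (h ∘ u) ≈⟨ assoc⁻¹ ⟩
              (h' ∘ h) ∘ u ≈⟨ h'h≈k ⟩∘⟨refl ⟩
              k ∘ u        ≈⟨ Pullback.mediator-p₁ outer c' ⟩
              h' ∘ q₁      ∎
            ghu≈gq₁ : g ∘ (h ∘ u) ≈ g ∘ q₁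
            ghu≈gq₁ = begin
              g ∘ (h ∘ u)   ≈⟨ assoc⁻¹ ⟩
              (g ∘ h) ∘ u   ≈⟨ gh≈tg₀ ⟩∘⟨refl ⟩
              (t ∘ g₀) ∘ u  ≈⟨ assoc ⟩
              t ∘ (g₀ ∘ u)  ≈⟨ refl⟩∘⟨ Pullback.mediator-p₂ outer c' ⟩
              t ∘ q₂        ≈⟨ ≈-sym c ⟩
              g ∘ q₁        ∎
        in u ,
           Pullback.jointly-mono right h'hu≈h'q₁ ghu≈gq₁ ,
           Pullback.mediator-p₂ outer c' ,
           λ v hv≈q₁ g₀v≈q₂ → Pullback.mediator-unique outer c' v
             (begin
               k ∘ v        ≈⟨ ≈-sym h'h≈k ⟩∘⟨refl ⟩
               (h' ∘ h) ∘ v ≈⟨ assoc ⟩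
               h' ∘ (h ∘ v) ≈⟨ refl⟩∘⟨ hv≈q₁ ⟩
               h' ∘ q₁      ∎)
             g₀v≈q₂ }
    where
    outer-commutes : ∀ {Q} (q₁ : Hom Q G) (q₂ : Hom Q T₀) → g ∘ q₁ ≈ t ∘ q₂ →
                     g' ∘ (h' ∘ q₁) ≈ w ∘ q₂
    outer-commutes q₁ q₂ c = begin
      g' ∘ (h' ∘ q₁) ≈⟨ assoc⁻¹ ⟩
      (g' ∘ h') ∘ q₁ ≈⟨ Pullback.commute right ⟩∘⟨refl ⟩
      (s ∘ g) ∘ q₁   ≈⟨ assoc ⟩
      s ∘ (g ∘ q₁)   ≈⟨ refl⟩∘⟨ c ⟩
      s ∘ (t ∘ q₂)   ≈⟨ assoc⁻¹ ⟩
      (s ∘ t) ∘ q₂   ≈⟨ ≈-sym w≈s∘t ⟩∘⟨refl ⟩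
      w ∘ q₂         ∎

module TypedAmalgamation {o ℓ e mℓ : Level} {𝐂 : Category o ℓ e}
  {M : CatDefs.MorClass 𝐂 mℓ}
  (adhesive : CatDefs.IsMAdhesive 𝐂 M) (horizontal-VK : CatDefs.HorizontalVK 𝐂 M)
  {TGA TGB TGC TGD : Category.Obj 𝐂}
  {tgDB : Category.Hom 𝐂 TGD TGB} {tgDC : Category.Hom 𝐂 TGD TGC}
  {tgBA : Category.Hom 𝐂 TGB TGA} {tgCA : Category.Hom 𝐂 TGC TGA}
  (M-tgDB : M tgDB) (M-tgDC : M tgDC) (M-tgBA : M tgBA) (M-tgCA : M tgCA)
  (types-pushout : CatDefs.IsPushout 𝐂 tgDB tgDC tgBA tgCA) where

  open Category 𝐂
  open CatDefs 𝐂
  open CategoryFacts 𝐂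
  open IsMAdhesive adhesive
  open Square tgDB tgDC tgBA tgCA

  restriction-in-M : ∀ {G G' TG TG'} {t : Hom TG' TG} {g : Hom G TG}
                     {g' : Hom G' TG'} {h : Hom G' G} →
                     IsRestrictionVia t g g' h → M t → M h
  restriction-in-M {t = t} {g} {g'} {h} r = pullback-stable h g' g t r

  typing-cube : ∀ {GA GB GC GD} (gA : Hom GA TGA) (gB : Hom GB TGB)
                (gC : Hom GC TGC) (gD : Hom GD TGD)
                {hDB : Hom GD GB} {hDC : Hom GD GC} (hBA : Hom GB GA) (hCA : Hom GC GA) →
                Agree gB gC gD hDB hDC → hBA ∘ hDB ≈ hCA ∘ hDC →
                gA ∘ hBA ≈ tgBA ∘ gB → gA ∘ hCA ≈ tgCA ∘ gC → Cube
  typing-cube gA gB gC gD {hDB} {hDC} hBA hCA (agree-B , agree-C) top frontB frontC = record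
    { m = tgDB ; n = tgDC ; f = tgBA ; g = tgCA
    ; m' = hDB ; n' = hDC ; f' = hBA ; g' = hCA
    ; a = gD ; b = gB ; c = gC ; d = gA
    ; bottom-commute = Pushout.commute types-pushout
    ; top-commute = top
    ; backB-commute = Pullback.commute agree-B
    ; backC-commute = Pullback.commute agree-C
    ; frontB-commute = frontB
    ; frontC-commute = frontC }

  typing-cube-VK :
    ∀ {GA GB GC GD} {gA : Hom GA TGA} {gB : Hom GB TGB} {gC : Hom GC TGC} {gD : Hom GD TGD}
      {hDB : Hom GD GB} {hDC : Hom GD GC} {hBA : Hom GB GA} {hCA : Hom GC GA}
      (agree : Agree gB gC gD hDB hDC) (top : hBA ∘ hDB ≈ hCA ∘ hDC)
      (frontB : gA ∘ hBA ≈ tgBA ∘ gB) (frontC : gA ∘ hCA ≈ tgCA ∘ gC) →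
    M hBA → M hCA →
    (IsPushout hDB hDC hBA hCA →
       IsRestrictionVia tgBA gA gB hBA × IsRestrictionVia tgCA gA gC hCA)
    × (IsRestrictionVia tgBA gA gB hBA × IsRestrictionVia tgCA gA gC hCA →
       IsPushout hDB hDC hBA hCA)
  typing-cube-VK {gA = gA} {gB} {gC} {gD} {hBA = hBA} {hCA} agree top frontB frontC M-hBA M-hCA =
    horizontal-VK (typing-cube gA gB gC gD hBA hCA agree top frontB frontC)
      M-tgDB M-tgDC M-tgBA M-tgCA
      (restriction-in-M (proj₁ agree) M-tgDB) (restriction-in-M (proj₂ agree) M-tgDC)
      M-hBA M-hCA types-pushout agree

  pushout-amalgamates :
    ∀ {GA GB GC GD} {gA : Hom GA TGA} {gB : Hom GB TGB} {gC : Hom GC TGC} {gD : Hom GD TGD}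
      {hDB : Hom GD GB} {hDC : Hom GD GC} {hBA : Hom GB GA} {hCA : Hom GC GA} →
    Agree gB gC gD hDB hDC → IsPushout hDB hDC hBA hCA →
    gA ∘ hBA ≈ tgBA ∘ gB → gA ∘ hCA ≈ tgCA ∘ gC → IsAmalgamation gA gB gC gD hDB hDC
  pushout-amalgamates {gA = gA} {gB} {gC} {hDB = hDB} {hDC} {hBA} {hCA} agree@(agree-B , agree-C) po frontB frontC =
    agree , hBA , hCA , proj₁ (restrictions po) , proj₂ (restrictions po) , po
    where
    M-hBA : M hBA
    M-hBA = pushout-stable hDC hDB hCA hBA (pushout-swap po) (restriction-in-M agree-C M-tgDC)
    M-hCA : M hCA
    M-hCA = pushout-stable hDB hDC hBA hCA po (restriction-in-M agree-B M-tgDB)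
    restrictions : IsPushout hDB hDC hBA hCA →
                   IsRestrictionVia tgBA gA gB hBA × IsRestrictionVia tgCA gA gC hCA
    restrictions = proj₁ (typing-cube-VK agree (Pushout.commute po) frontB frontC M-hBA M-hCA)

  restrictions-amalgamate :
    ∀ {GA GB GC GD} {gA : Hom GA TGA} {gB : Hom GB TGB} {gC : Hom GC TGC} {gD : Hom GD TGD}
      {hDB : Hom GD GB} {hDC : Hom GD GC} {hBA : Hom GB GA} {hCA : Hom GC GA} →
    Agree gB gC gD hDB hDC →
    IsRestrictionVia tgBA gA gB hBA → IsRestrictionVia tgCA gA gC hCA →
    hBA ∘ hDB ≈ hCA ∘ hDC → IsAmalgamation gA gB gC gD hDB hDC
  restrictions-amalgamate {hBA = hBA} {hCA} agree restriction-B restriction-C top =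
    agree , hBA , hCA , restriction-B , restriction-C ,
    proj₂ (typing-cube-VK agree top
             (Pullback.commute restriction-B) (Pullback.commute restriction-C)
             (restriction-in-M restriction-B M-tgBA) (restriction-in-M restriction-C M-tgCA))
      (restriction-B , restriction-C)

  -- Both legs of an agreement span induce the same typing of G_D over TG_A;
  -- this is what lets the pushout of the span be typed over TG_A.
  agreeing-span-commutes : ∀ {GB GC GD} {gB : Hom GB TGB} {gC : Hom GC TGC} {gD : Hom GD TGD}
                           {hDB : Hom GD GB} {hDC : Hom GD GC} → Agree gB gC gD hDB hDC →
                           (tgBA ∘ gB) ∘ hDB ≈ (tgCA ∘ gC) ∘ hDC
  agreeing-span-commutes {gB = gB} {gC} {gD} {hDB} {hDC} (agree-B , agree-C) = begin
    (tgBA ∘ gB) ∘ hDB   ≈⟨ assoc ⟩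
    tgBA ∘ (gB ∘ hDB)   ≈⟨ refl⟩∘⟨ Pullback.commute agree-B ⟩
    tgBA ∘ (tgDB ∘ gD)  ≈⟨ assoc⁻¹ ⟩
    (tgBA ∘ tgDB) ∘ gD  ≈⟨ Pushout.commute types-pushout ⟩∘⟨refl ⟩
    (tgCA ∘ tgDC) ∘ gD  ≈⟨ assoc ⟩
    tgCA ∘ (tgDC ∘ gD)  ≈⟨ refl⟩∘⟨ ≈-sym (Pullback.commute agree-C) ⟩
    tgCA ∘ (gC ∘ hDC)   ≈⟨ assoc⁻¹ ⟩
    (tgCA ∘ gC) ∘ hDC   ∎

  -- Existence of the amalgamation: push out the agreement span (its legs
  -- are in M) and type the pushout by the induced morphism.
  amalgamation-exists : ∀ {GB GC GD} {gB : Hom GB TGB} {gC : Hom GC TGC} {gD : Hom GD TGD}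
                        {hDB : Hom GD GB} {hDC : Hom GD GC} → Agree gB gC gD hDB hDC →
                        Σ Obj λ GA → Σ (Hom GA TGA) λ gA →
                          IsAmalgamation gA gB gC gD hDB hDC
  amalgamation-exists {gB = gB} {gC} {hDB = hDB} {hDC} agree@(agree-B , _) =
    let (GA , _ , _ , po) = pushouts-along-M hDB hDC (restriction-in-M agree-B M-tgDB)
        commutes = agreeing-span-commutes agree
    in GA , Pushout.mediator po (tgBA ∘ gB) (tgCA ∘ gC) commutes ,
       pushout-amalgamates agree po (Pushout.mediator-i₁ po commutes)
                                    (Pushout.mediator-i₂ po commutes)

  amalgamation-unique : ∀ {GA GA' GB GC GD} {gA : Hom GA TGA} {gA' : Hom GA' TGA}
                        {gB : Hom GB TGB} {gC : Hom GC TGC} {gD : Hom GD TGD}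
                        {hDB : Hom GD GB} {hDC : Hom GD GC} →
                        IsAmalgamation gA gB gC gD hDB hDC →
                        IsAmalgamation gA' gB gC gD hDB hDC → TypedIso gA gA'
  amalgamation-unique {GA} {GA'} {gA = gA} {gA'} {gB} {gC} {hDB = hDB} {hDC}
    (_ , hBA , hCA , restriction-B , restriction-C , po)
    (_ , hBA' , hCA' , restriction-B' , restriction-C' , po') =
    comparison , pushout-comparison-iso po po' , Pushout.jointly-epi po respects-B respects-C
    where
    commutes' : hBA' ∘ hDB ≈ hCA' ∘ hDC
    commutes' = Pushout.commute po'
    comparison : Hom GA GA'
    comparison = Pushout.mediator po hBA' hCA' commutes'
    respects-B : (gA' ∘ comparison) ∘ hBA ≈ gA ∘ hBA
    respects-B = begin
      (gA' ∘ comparison) ∘ hBA ≈⟨ assoc ⟩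
      gA' ∘ (comparison ∘ hBA) ≈⟨ refl⟩∘⟨ Pushout.mediator-i₁ po commutes' ⟩
      gA' ∘ hBA'               ≈⟨ Pullback.commute restriction-B' ⟩
      tgBA ∘ gB                ≈⟨ ≈-sym (Pullback.commute restriction-B) ⟩
      gA ∘ hBA                 ∎
    respects-C : (gA' ∘ comparison) ∘ hCA ≈ gA ∘ hCA
    respects-C = begin
      (gA' ∘ comparison) ∘ hCA ≈⟨ assoc ⟩
      gA' ∘ (comparison ∘ hCA) ≈⟨ refl⟩∘⟨ Pushout.mediator-i₂ po commutes' ⟩
      gA' ∘ hCA'               ≈⟨ Pullback.commute restriction-C' ⟩
      tgCA ∘ gC                ≈⟨ ≈-sym (Pullback.commute restriction-C) ⟩
      gA ∘ hCA                 ∎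

  composition : CompositionProperty
  composition _ _ _ _ _ agree =
    amalgamation-exists agree , λ _ _ → amalgamation-unique

  -- Existence of the decomposition: restrict g_A along tg_BA, tg_CA and
  -- tg_BA ∘ tg_DB; the induced G_D → G_B, G_D → G_C exhibit g_D as a
  -- restriction of g_B and g_C by pullback cancellation.
  decomposition-exists : ∀ {GA} (gA : Hom GA TGA) → Decomposition gA
  decomposition-exists gA
    with pullbacks-along-M tgBA gA M-tgBA
       | pullbacks-along-M tgCA gA M-tgCA
       | pullbacks-along-M (tgBA ∘ tgDB) gA (comp-closed tgBA tgDB M-tgBA M-tgDB)
  ... | _ , _ , gB , restriction-B | _ , _ , gC , restriction-C | _ , k , gD , restriction-D =
    record
    { gB = gB ; gC = gC ; gD = gD ; hDB = hDB ; hDC = hDC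
    ; gD-restriction = k , restriction-D
    ; amalgamation = restrictions-amalgamate agree restriction-B restriction-C
                       (≈-trans (Pullback.mediator-p₁ restriction-B commutes-B)
                                (≈-sym (Pullback.mediator-p₁ restriction-C commutes-C)))
    }
    where
    commutes-B : gA ∘ k ≈ tgBA ∘ (tgDB ∘ gD)
    commutes-B = ≈-trans (Pullback.commute restriction-D) assoc
    commutes-C : gA ∘ k ≈ tgCA ∘ (tgDC ∘ gD)
    commutes-C = ≈-trans (Pullback.commute restriction-D)
                         (≈-trans (Pushout.commute types-pushout ⟩∘⟨refl) assoc)
    hDB = Pullback.mediator restriction-B k (tgDB ∘ gD) commutes-B
    hDC = Pullback.mediator restriction-C k (tgDC ∘ gD) commutes-C
    agree : Agree gB gC gD hDB hDC
    agree =
      pullback-cancel restriction-B restriction-D ≈-refl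
        (Pullback.mediator-p₁ restriction-B commutes-B)
        (Pullback.mediator-p₂ restriction-B commutes-B) ,
      pullback-cancel restriction-C restriction-D (Pushout.commute types-pushout)
        (Pullback.mediator-p₁ restriction-C commutes-C)
        (Pullback.mediator-p₂ restriction-C commutes-C)

  -- Uniqueness of the decomposition: each component is a restriction of
  -- g_A along a fixed morphism, hence unique up to isomorphism.
  decomposition-unique : ∀ {GA} {gA : Hom GA TGA} (δ δ' : Decomposition gA) →
                         TypedIso (Decomposition.gB δ) (Decomposition.gB δ') ×
                         TypedIso (Decomposition.gC δ) (Decomposition.gC δ') ×
                         TypedIso (Decomposition.gD δ) (Decomposition.gD δ')
  decomposition-unique δ δ' =
    restrictions-unique (restriction-B δ) (restriction-B δ') ,
    restrictions-unique (restriction-C δ) (restriction-C δ') ,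
    restrictions-unique (Decomposition.gD-restriction δ) (Decomposition.gD-restriction δ')
    where
    restriction-B : ∀ {GA} {gA : Hom GA TGA} (δ : Decomposition gA) →
                    IsRestriction tgBA gA (Decomposition.gB δ)
    restriction-B δ = let (_ , hBA , _ , rB , _) = Decomposition.amalgamation δ in hBA , rB
    restriction-C : ∀ {GA} {gA : Hom GA TGA} (δ : Decomposition gA) →
                    IsRestriction tgCA gA (Decomposition.gC δ)
    restriction-C δ = let (_ , _ , hCA , _ , rC , _) = Decomposition.amalgamation δ in hCA , rC

  decomposition : DecompositionProperty
  decomposition gA = decomposition-exists gA , decomposition-unique

fact4p2 : ∀ {o ℓ e mℓ : Level} (𝐂 : Category o ℓ e)
    (M : CatDefs.MorClass 𝐂 mℓ) →
    CatDefs.IsMAdhesive 𝐂 M →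
    CatDefs.HorizontalVK 𝐂 M →
    CatDefs.EffectivePushouts 𝐂 M →
    ∀ {TGA TGB TGC TGD : Category.Obj 𝐂}
    (tgDB : Category.Hom 𝐂 TGD TGB) (tgDC : Category.Hom 𝐂 TGD TGC)
    (tgBA : Category.Hom 𝐂 TGB TGA) (tgCA : Category.Hom 𝐂 TGC TGA) →
    M tgDB → M tgDC → M tgBA → M tgCA →
    CatDefs.IsPushout 𝐂 tgDB tgDC tgBA tgCA →
    CatDefs.Square.CompositionProperty 𝐂 tgDB tgDC tgBA tgCA
    × CatDefs.Square.DecompositionProperty 𝐂 tgDB tgDC tgBA tgCA
-- Fact 4.2.
fact4p2 𝐂 M adhesive horizontal-VK _ _ _ _ _ M-tgDB M-tgDC M-tgBA M-tgCA types-pushout =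
  composition , decomposition
  where open TypedAmalgamation adhesive horizontal-VK M-tgDB M-tgDC M-tgBA M-tgCA types-pushout
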